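{- For every $n \in \mathbb{N}$, $|\mathcal{D}_n| \leq 2\binom{n}{2} + n + 1$.
   Context: For $n \in \mathbb{N}$ and $S \subset [n]$, let $T_{n+1}(S)$ be the tournament on vertices $\{y,x_1,\ldots,x_n\}$ with $x_i \to x_j$ for $i<j$ and $y \to x_i$ if and only if $i \in S$. Let $\mathcal{D}_n$ be the set of $S \subset [n]$ such that $T_{n+1}(S)$ has at least two distinct $n$-element vertex subsets inducing transitive sub-tournaments. -}

module Defs where

open import Data.Nat using (ℕ; zero; suc)
open import Data.Fin using (Fin; zero; suc; _<_)
open import Data.Fin.Subset using (Subset; _∈_; _∉_; ∣_∣)
open import Data.Empty using (⊥)
open import Data.Product using (Σ; ∃; _×_; _,_)
open import Relation.Binary.PropositionalEquality using (_≡_; _≢_)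

-- The tournament T_{n+1}(S).  Vertex set: Fin (suc n), where
--   zero   represents y,
--   suc i  represents x_{i+1}   (0-indexed: S ⊆ Fin n stands for S ⊆ [n]).
-- Arc S u v  means  u → v.
Arc : ∀ {n} → Subset n → Fin (suc n) → Fin (suc n) → Set
Arc S zero    zero    = ⊥
Arc S zero    (suc j) = j ∈ S
Arc S (suc i) zero    = i ∉ S
Arc S (suc i) (suc j) = i < j

InducesTransitive : ∀ {n} → Subset n → Subset (suc n) → Set
InducesTransitive {n} S U =
  ∀ (a b c : Fin (suc n)) → a ∈ U → b ∈ U → c ∈ U →
  Arc S a b → Arc S b c → Arc S a c

InD : (n : ℕ) → Subset n → Set
InD n S = Σ (Subset (suc n)) λ U → Σ (Subset (suc n)) λ V →
  U ≢ V × ∣ U ∣ ≡ n × ∣ V ∣ ≡ n × InducesTransitive S U × InducesTransitive S V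

-- Two distinct n-vertex subsets cannot both omit y, so some transitive n-subset
-- is {y} ∪ {x_i : i ∈ T} with T missing at most one index. Transitivity of
-- y → x_j → x_l then makes S upward closed on T, which forces S to be empty or,
-- after its least element, either a final segment or missing at most one index.
-- Splitting on the first coordinate, the number of such shapes satisfies
-- f(n+1) = f(n) + (2n + 1), f(0) = 1, which is exactly the bound.
module Submission where

open import Defs
open import Data.Nat using (ℕ; zero; suc; _+_; _*_; _≤_; z≤n; s≤s; z<s; s<s)
open import Data.Nat.Properties
  using (≤-trans; ≤-antisym; ≤-reflexive; +-mono-≤; +-suc; +-comm; m≤m+n; m≤n⇒m≤1+n)
open import Data.Nat.Combinatorics using (_C_; nC1≡n; nCk+nC[k+1]≡[n+1]C[k+1])
open import Data.Nat.Tactic.RingSolver using (solve-∀)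
open import Data.Fin using (zero; suc; _<_)
open import Data.Fin.Subset using (Subset; Side; inside; outside; _∈_; _⊆_; ∣_∣)
  renaming (⊤ to full)
open import Data.Fin.Subset.Properties
  using (drop-there; drop-∷-⊆; ⊆-max; ⊆-antisym; ∣p∣≤n; ∣p∣≡n⇒p≡⊤; p⊆q⇒∣p∣≤∣q∣)
open import Data.Bool using () renaming (_≟_ to _≟ˢ_)
open import Data.Vec using ([]; _∷_; here; there)
open import Data.List using (List; []; _∷_; length)
open import Data.List.Relation.Unary.All as All using (All; []; _∷_)
open import Data.List.Relation.Unary.AllPairs using ([]; _∷_)
open import Data.List.Relation.Unary.Unique.Propositional using (Unique)
open import Data.Unit using (⊤; tt)
open import Data.Empty using (⊥-elim)
open import Data.Product using (_,_)
open import Data.Sum using (_⊎_; inj₁; inj₂)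
open import Function using (_∘_; id)
open import Relation.Nullary using (yes; no)
open import Relation.Binary.PropositionalEquality
  using (_≡_; refl; sym; trans; cong; subst; module ≡-Reasoning)

AtMost : {A : Set} → ℕ → (A → Set) → Set
AtMost {A} k P = (L : List A) → Unique L → All P L → length L ≤ k

atMost-mono : ∀ {A : Set} {P : A → Set} {a b} → a ≤ b → AtMost a P → AtMost b P
atMost-mono a≤b bound L u ps = ≤-trans (bound L u ps) a≤b

atMost-⊆ : ∀ {A : Set} {P Q : A → Set} {k} →
  (∀ {x} → P x → Q x) → AtMost k Q → AtMost k P
atMost-⊆ P⇒Q bound L u ps = bound L u (All.map P⇒Q ps)

atMost-subsingleton : ∀ {A : Set} {P : A → Set} →
  (∀ {x y} → P x → P y → x ≡ y) → AtMost 1 P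
atMost-subsingleton eq []          _               _             = z≤n
atMost-subsingleton eq (_ ∷ [])    _               _             = s≤s z≤n
atMost-subsingleton eq (_ ∷ _ ∷ _) ((x≢y ∷ _) ∷ _) (px ∷ py ∷ _) = ⊥-elim (x≢y (eq px py))

module _ {m : ℕ} where

  tailsWith : Side → List (Subset (suc m)) → List (Subset m)
  tailsWith b [] = []
  tailsWith b ((c ∷ s) ∷ L) with b ≟ˢ c
  ... | yes _ = s ∷ tailsWith b L
  ... | no _  = tailsWith b L

  length-tailsWith : ∀ L →
    length L ≡ length (tailsWith outside L) + length (tailsWith inside L)
  length-tailsWith [] = refl
  length-tailsWith ((outside ∷ s) ∷ L) = cong suc (length-tailsWith L)
  length-tailsWith ((inside ∷ s) ∷ L) = trans (cong suc (length-tailsWith L))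
    (sym (+-suc (length (tailsWith outside L)) (length (tailsWith inside L))))

  All-tailsWith : ∀ {P : Subset (suc m) → Set} {Q : Subset m → Set} b →
    (∀ {s} → P (b ∷ s) → Q s) → ∀ {L} → All P L → All Q (tailsWith b L)
  All-tailsWith b f [] = []
  All-tailsWith b f {(c ∷ s) ∷ L} (p ∷ ps) with b ≟ˢ c
  ... | yes refl = f p ∷ All-tailsWith b f ps
  ... | no _     = All-tailsWith b f ps

  Unique-tailsWith : ∀ b {L} → Unique L → Unique (tailsWith b L)
  Unique-tailsWith b [] = []
  Unique-tailsWith b {(c ∷ s) ∷ L} (x∉L ∷ u) with b ≟ˢ c
  ... | yes refl = All-tailsWith b (λ ne eq → ne (cong (b ∷_) eq)) x∉L ∷ Unique-tailsWith b u
  ... | no _     = Unique-tailsWith b u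

  atMost-∷ : ∀ {P : Subset (suc m) → Set} {k l} →
    AtMost k (P ∘ (outside ∷_)) → AtMost l (P ∘ (inside ∷_)) → AtMost (k + l) P
  atMost-∷ boundₒ boundᵢ L u ps = begin
    length L                                                  ≡⟨ length-tailsWith L ⟩
    length (tailsWith outside L) + length (tailsWith inside L) ≤⟨ +-mono-≤
      (boundₒ _ (Unique-tailsWith outside u) (All-tailsWith outside id ps))
      (boundᵢ _ (Unique-tailsWith inside u) (All-tailsWith inside id ps)) ⟩
    _                                                          ∎
    where open Data.Nat.Properties.≤-Reasoning

atMost-Subset0 : ∀ {P : Subset 0 → Set} → AtMost 1 P
atMost-Subset0 = atMost-subsingleton λ { {[]} {[]} _ _ → refl }

atMost-full : ∀ {k} → AtMost 1 (_≡ full {k})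
atMost-full = atMost-subsingleton (λ p q → trans p (sym q))

UpSet : ∀ {k} → Subset k → Set
UpSet []            = ⊤
UpSet (outside ∷ s) = UpSet s
UpSet (inside ∷ s)  = s ≡ full

AlmostFull : ∀ {k} → Subset k → Set
AlmostFull []            = ⊤
AlmostFull (outside ∷ s) = s ≡ full
AlmostFull (inside ∷ s)  = AlmostFull s

Admissible : ∀ {k} → Subset k → Set
Admissible []            = ⊤
Admissible (outside ∷ s) = Admissible s
Admissible (inside ∷ s)  = UpSet s ⊎ AlmostFull s

upSet-full : ∀ k → UpSet (full {k})
upSet-full zero    = tt
upSet-full (suc k) = refl

almostFull-full : ∀ k → AlmostFull (full {k})
almostFull-full zero    = tt
almostFull-full (suc k) = almostFull-full k

atMost-UpSet : ∀ k → AtMost (suc k) (UpSet {k})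
atMost-UpSet zero    = atMost-Subset0
atMost-UpSet (suc k) =
  atMost-mono (≤-reflexive (+-comm (suc k) 1)) (atMost-∷ (atMost-UpSet k) atMost-full)

atMost-AlmostFull : ∀ k → AtMost (suc k) (AlmostFull {k})
atMost-AlmostFull zero    = atMost-Subset0
atMost-AlmostFull (suc k) = atMost-∷ atMost-full (atMost-AlmostFull k)

atMost-UpSet⊎AlmostFull : ∀ k → AtMost (k + k + 1) (λ (s : Subset k) → UpSet s ⊎ AlmostFull s)
atMost-UpSet⊎AlmostFull zero    = atMost-Subset0
atMost-UpSet⊎AlmostFull (suc k) = atMost-mono (m≤m+n (suc k + suc k) 1) (atMost-∷
  (atMost-⊆ (λ { (inj₁ up) → up ; (inj₂ refl) → upSet-full k }) (atMost-UpSet k))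
  (atMost-⊆ (λ { (inj₁ refl) → almostFull-full k ; (inj₂ af) → af }) (atMost-AlmostFull k)))

[1+n]C2≡n+nC2 : ∀ n → suc n C 2 ≡ n + n C 2
[1+n]C2≡n+nC2 n = trans (sym (nCk+nC[k+1]≡[n+1]C[k+1] n 1)) (cong (_+ n C 2) (nC1≡n n))

bound-suc : ∀ n → 2 * (n C 2) + n + 1 + (n + n + 1) ≡ 2 * (suc n C 2) + suc n + 1
bound-suc n = begin
  2 * c + n + 1 + (n + n + 1) ≡⟨ shuffle n c ⟩
  2 * (n + c) + suc n + 1     ≡⟨ cong (λ x → 2 * x + suc n + 1) (sym ([1+n]C2≡n+nC2 n)) ⟩
  2 * (suc n C 2) + suc n + 1 ∎
  where
  open ≡-Reasoning
  c = n C 2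
  shuffle : ∀ n c → 2 * c + n + 1 + (n + n + 1) ≡ 2 * (n + c) + suc n + 1
  shuffle = solve-∀

atMost-Admissible : ∀ n → AtMost (2 * (n C 2) + n + 1) (Admissible {n})
atMost-Admissible zero    = atMost-Subset0
atMost-Admissible (suc n) = atMost-mono (≤-reflexive (bound-suc n))
  (atMost-∷ (atMost-Admissible n) (atMost-UpSet⊎AlmostFull n))

UpClosedOn : ∀ {k} → Subset k → Subset k → Set
UpClosedOn T S = ∀ {j l} → j < l → j ∈ T → l ∈ T → j ∈ S → l ∈ S

upClosedOn-tail : ∀ {k b c} {t s : Subset k} → UpClosedOn (c ∷ t) (b ∷ s) → UpClosedOn t s
upClosedOn-tail closed j<l j∈t l∈t j∈s =
  drop-there (closed (s<s j<l) (there j∈t) (there l∈t) (there j∈s))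

upClosedOn-head : ∀ {k} {t s : Subset k} → UpClosedOn (inside ∷ t) (inside ∷ s) → t ⊆ s
upClosedOn-head closed l∈t = drop-there (closed z<s here (there l∈t) here)

full-of-⊆ : ∀ {k} {t s : Subset k} → t ⊆ s → k ≤ ∣ t ∣ → s ≡ full
full-of-⊆ {s = s} t⊆s k≤∣t∣ =
  ∣p∣≡n⇒p≡⊤ (≤-antisym (∣p∣≤n s) (≤-trans k≤∣t∣ (p⊆q⇒∣p∣≤∣q∣ t⊆s)))

almostFull-of-⊆ : ∀ {k} {t s : Subset k} → t ⊆ s → k ≤ suc ∣ t ∣ → AlmostFull s
almostFull-of-⊆ {t = []}          {[]}          _   _         = tt
almostFull-of-⊆ {t = inside ∷ t}  {outside ∷ s} t⊆s _         with t⊆s here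
... | ()
almostFull-of-⊆ {t = outside ∷ t} {outside ∷ s} t⊆s (s≤s k≤∣t∣) = full-of-⊆ (drop-∷-⊆ t⊆s) k≤∣t∣
almostFull-of-⊆ {suc k} {outside ∷ t} {inside ∷ s} t⊆s (s≤s k≤∣t∣) =
  subst AlmostFull (sym (full-of-⊆ (drop-∷-⊆ t⊆s) k≤∣t∣)) (almostFull-full k)
almostFull-of-⊆ {t = inside ∷ t}  {inside ∷ s}  t⊆s (s≤s k≤∣t∣) = almostFull-of-⊆ (drop-∷-⊆ t⊆s) k≤∣t∣

upSet-of-upClosed : ∀ {k} {s : Subset k} → UpClosedOn full s → UpSet s
upSet-of-upClosed {s = []}          _      = tt
upSet-of-upClosed {s = outside ∷ s} closed = upSet-of-upClosed (upClosedOn-tail closed)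
upSet-of-upClosed {s = inside ∷ s}  closed = ⊆-antisym (⊆-max s) (upClosedOn-head closed)

admissible-of-upClosedOn : ∀ {k} {t s : Subset k} →
  UpClosedOn t s → k ≤ suc ∣ t ∣ → Admissible s
admissible-of-upClosedOn {t = []}          {[]}          _      _             = tt
admissible-of-upClosedOn {t = inside ∷ t}  {outside ∷ s} closed (s≤s k≤1+∣t∣) =
  admissible-of-upClosedOn (upClosedOn-tail closed) k≤1+∣t∣
admissible-of-upClosedOn {t = outside ∷ t} {outside ∷ s} closed (s≤s k≤∣t∣) =
  admissible-of-upClosedOn (upClosedOn-tail closed) (m≤n⇒m≤1+n k≤∣t∣)
admissible-of-upClosedOn {t = inside ∷ t}  {inside ∷ s}  closed (s≤s k≤∣t∣) =
  inj₂ (almostFull-of-⊆ (upClosedOn-head closed) k≤∣t∣)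
admissible-of-upClosedOn {t = outside ∷ t} {inside ∷ s}  closed (s≤s k≤∣t∣) =
  inj₁ (upSet-of-upClosed (subst (λ t → UpClosedOn t s) t≡full (upClosedOn-tail closed)))
  where
  t≡full : t ≡ full
  t≡full = full-of-⊆ id k≤∣t∣

admissible-of-transitive : ∀ {n} {S T : Subset n} →
  suc ∣ T ∣ ≡ n → InducesTransitive S (inside ∷ T) → Admissible S
admissible-of-transitive {S = S} {T} ∣y∷T∣≡n transitive =
  admissible-of-upClosedOn upClosed (≤-reflexive (sym ∣y∷T∣≡n))
  where
  upClosed : UpClosedOn T S
  upClosed j<l j∈T l∈T j∈S =
    transitive zero (suc _) (suc _) here (there j∈T) (there l∈T) j∈S j<l

admissible-of-InD : ∀ n {S} → InD n S → Admissible S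
admissible-of-InD n (inside ∷ U , _ , _ , ∣U∣≡n , _ , transitiveU , _) =
  admissible-of-transitive ∣U∣≡n transitiveU
admissible-of-InD n (outside ∷ U , inside ∷ V , _ , _ , ∣V∣≡n , _ , transitiveV) =
  admissible-of-transitive ∣V∣≡n transitiveV
admissible-of-InD n (outside ∷ U , outside ∷ V , U≢V , ∣U∣≡n , ∣V∣≡n , _) =
  ⊥-elim (U≢V (cong (outside ∷_) (trans (∣p∣≡n⇒p≡⊤ ∣U∣≡n) (sym (∣p∣≡n⇒p≡⊤ ∣V∣≡n)))))

mainTheorem7 : (n : ℕ) → (L : List (Subset n)) → Unique L → All (InD n) L →
    length L ≤ 2 * (n C 2) + n + 1
mainTheorem7 n L unique inD =
  atMost-Admissible n L unique (All.map (admissible-of-InD n) inD)
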